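{- Let $n\geq 2$. Then the set \[ \{q\in M_{p_{n-1}}\mid p_n<q<p_np_{n+1},\ q\neq p_n^2\} \] consists of consecutive primes; that is, it equals the set of all primes $q$ with $p_n<q<p_np_{n+1}$.
   Context: $p_1=2<p_2=3<p_3=5<\cdots$ denotes the sequence of all primes. For $m\geq1$, $M_{p_m}$ is the set of positive integers not divisible by any of $p_1,\dots,p_m$. -}

module Defs where

open import Data.Nat using (ℕ; zero; suc; _*_; _<_; _≤_; _∸_)
open import Data.Nat.Divisibility using (_∣_)
open import Data.Nat.Primality using (Prime; prime?)
open import Data.List using (List; length; filter; upTo)
open import Data.Product using (_×_)
open import Relation.Nullary using (¬_)
open import Relation.Binary.PropositionalEquality using (_≡_)

primesBelow : ℕ → ℕ
primesBelow x = length (filter prime? (upTo x))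

-- IsNthPrime m p : p is the m-th prime p_m (1-indexed: p_1 = 2, p_2 = 3, ...),
-- i.e. p is prime and exactly m - 1 primes are smaller than p.
IsNthPrime : ℕ → ℕ → Set
IsNthPrime m p = Prime p × (suc (primesBelow p) ≡ m)

-- InM m q : q ∈ M_{p_m}, i.e. q is positive and not divisible by any of p_1, ..., p_m.
InM : ℕ → ℕ → Set
InM m q = (0 < q) × (∀ i r → 1 ≤ i → i ≤ m → IsNthPrime i r → ¬ (r ∣ q))

module Submission where

-- "⇐" is immediate: a prime q > p_n is none of p_1, …, p_{n-1}, and it is
-- not the square p_n².  "⇒" rests on two facts.
--   (1) Bertrand-type bound: every p ≥ 2 has a prime in (p, p²], hence
--       p_{n+1} ≤ p_n².  For p ≥ 19 we use Chebyshev's argument with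
--       C = binom(2m, m), m = p⌊p/2⌋: by Legendre's formula every prime power
--       dividing C is at most 2m, so if all prime factors of C were ≤ p we
--       would get 2^m ≤ C ≤ (2m)^p < 2^m.  Small p are settled by hand.
--   (2) Counting the primes below x shows that no prime lies strictly
--       between p_n and p_{n+1}, and that the primes below p_n are exactly
--       p_1, …, p_{n-1}.  So every prime factor of q ∈ M_{p_{n-1}} is ≥ p_n,
--       every factor b ≥ 2 of q is p_n or ≥ p_{n+1}, and a composite
--       q = a·b is therefore p_n² or at least p_n p_{n+1}.
-- The file develops elementary prime facts, q-adic valuations, Legendre's
-- formula, Chebyshev's bound, prime counting and the factor dichotomy, in
-- this order, and derives the proposition at the end.

open import Defs
open import Data.Nat
open import Data.Nat.Properties
open import Data.Nat.Divisibility
open import Data.Nat.Primality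
open import Data.Nat.Primality.Factorisation using (factorise)
open import Data.Nat.Combinatorics using (k![n∸k]!∣n!)
open import Data.Nat.Induction using (<-rec)
open import Data.Nat.Tactic.RingSolver using (solve-∀)
open import Data.List using (length; filter; upTo; _∷_; []; _++_; [_])
open import Data.Nat.ListAction using (product)
open import Data.List.Properties using (upTo-∷ʳ; length-++; filter-++)
open import Data.List.Relation.Unary.All using (_∷_)
open import Data.Product
open import Data.Sum
open import Data.Empty using (⊥-elim)
open import Relation.Nullary
open import Relation.Nullary.Decidable using (from-yes)
open import Relation.Binary.PropositionalEquality hiding ([_])
open import Function.Bundles using (_⇔_; mk⇔)

prime≥2 : ∀ {p} → Prime p → 2 ≤ p
prime≥2 {p} pp = nonTrivial⇒n>1 p {{prime⇒nonTrivial pp}}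

prime∣prime : ∀ {r q} → Prime r → Prime q → r ∣ q → r ≡ q
prime∣prime pr pq r∣q with prime⇒irreducible pq r∣q
... | inj₁ refl = ⊥-elim (¬prime[1] pr)
... | inj₂ r≡q  = r≡q

∃prime-factor : ∀ {n} → 2 ≤ n → ∃[ r ] Prime r × r ∣ n
∃prime-factor {n} 2≤n with factorise n {{>-nonZero (<-trans z<s 2≤n)}}
... | record { factors = r ∷ rs ; isFactorisation = n≡ ; factorsPrime = pr ∷ _ } =
  r , pr , divides (product rs) (trans n≡ (*-comm r (product rs)))
... | record { factors = [] ; isFactorisation = n≡1 } =
  ⊥-elim (<-irrefl (sym n≡1) 2≤n)

-- A prime dividing k! is at most k (Euclid's lemma on k! = k·(k-1)!).
prime∣!⇒≤ : ∀ {r} k → Prime r → r ∣ k ! → r ≤ k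
prime∣!⇒≤ zero    pr r∣1 = ⊥-elim (¬prime[1] (subst Prime (∣1⇒≡1 r∣1) pr))
prime∣!⇒≤ (suc k) pr r∣k+1! with euclidsLemma (suc k) (k !) pr r∣k+1!
... | inj₁ r∣k+1 = ∣⇒≤ r∣k+1
... | inj₂ r∣k!  = m≤n⇒m≤1+n (prime∣!⇒≤ k pr r∣k!)

module Valuation {q : ℕ} (q-prime : Prime q) where

  instance
    q≢0 : NonZero q
    q≢0 = prime⇒nonZero q-prime

  q≥2 : 2 ≤ q
  q≥2 = prime≥2 q-prime

  q∤1 : ¬ (q ∣ 1)
  q∤1 q∣1 = <⇒≱ q≥2 (∣⇒≤ q∣1)

  record Val (X e : ℕ) : Set where
    constructor val
    field
      power∣  : q ^ e ∣ X
      maximal : ¬ (q ^ suc e ∣ X)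

  val-zero : ∀ {X} → ¬ (q ∣ X) → Val X 0
  val-zero {X} q∤X = val (1∣ X) λ q¹∣X → q∤X (subst (_∣ X) (*-identityʳ q) q¹∣X)

  ^-monoʳ-∣ : ∀ {i j} → i ≤ j → q ^ i ∣ q ^ j
  ^-monoʳ-∣ {i} i≤j with m≤n⇒∃[o]m+o≡n i≤j
  ... | k , refl = divides (q ^ k) (trans (^-distribˡ-+-* q i k) (*-comm (q ^ i) (q ^ k)))

  ∣⇒≤-val : ∀ {X e} i → q ^ i ∣ X → Val X e → i ≤ e
  ∣⇒≤-val {e = e} i qⁱ∣X (val _ q^e+1∤X) with i ≤? e
  ... | yes i≤e = i≤e
  ... | no  i≰e = ⊥-elim (q^e+1∤X (∣-trans (^-monoʳ-∣ (≰⇒> i≰e)) qⁱ∣X))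

  val-unique : ∀ {X a b} → Val X a → Val X b → a ≡ b
  val-unique {a = a} {b} va vb = ≤-antisym (∣⇒≤-val a (Val.power∣ va) vb) (∣⇒≤-val b (Val.power∣ vb) va)

  val-exists : ∀ X → 0 < X → ∃[ e ] Val X e
  val-exists = <-rec (λ X → 0 < X → ∃[ e ] Val X e) divide-out
    where
    divide-out : ∀ X → (∀ {Y} → Y < X → 0 < Y → ∃[ e ] Val Y e) → 0 < X → ∃[ e ] Val X e
    divide-out X rec X>0 with q ∣? X
    ... | no q∤X = 0 , val-zero q∤X
    ... | yes (divides Y refl) = suc e , val q^e+1∣Yq q^e+2∤Yq
      where
      Y>0 : 0 < Y
      Y>0 = >-nonZero⁻¹ Y {{m*n≢0⇒m≢0 Y {{>-nonZero X>0}}}}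
      valY : ∃[ e ] Val Y e
      valY = rec (m<m*n Y q {{>-nonZero Y>0}} q≥2) Y>0
      e : ℕ
      e = proj₁ valY
      q^e+1∣Yq : q * q ^ e ∣ Y * q
      q^e+1∣Yq = subst (q * q ^ e ∣_) (*-comm q Y) (*-monoʳ-∣ q (Val.power∣ (proj₂ valY)))
      q^e+2∤Yq : ¬ (q * (q * q ^ e) ∣ Y * q)
      q^e+2∤Yq d = Val.maximal (proj₂ valY) (*-cancelˡ-∣ q (subst (q * (q * q ^ e) ∣_) (*-comm Y q) d))

  val-mul : ∀ {Y e R} s → Val Y e → ¬ (q ∣ R) → Val (q ^ s * (Y * R)) (s + e)
  val-mul {Y} {e} {R} s (val (divides y refl) q^e+1∤Y) q∤R = val q^s+e∣ q^s+e+1∤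
    where
    regroup : ∀ a b y R → a * (y * b * R) ≡ (a * b) * (y * R)
    regroup = solve-∀
    X≡ : q ^ s * (y * q ^ e * R) ≡ q ^ (s + e) * (y * R)
    X≡ = trans (regroup (q ^ s) (q ^ e) y R) (cong (_* (y * R)) (sym (^-distribˡ-+-* q s e)))
    q^s+e∣ : q ^ (s + e) ∣ q ^ s * (y * q ^ e * R)
    q^s+e∣ = subst (q ^ (s + e) ∣_) (sym X≡) (m∣m*n (y * R))
    q∤y : ¬ (q ∣ y)
    q∤y q∣y = q^e+1∤Y (*-monoˡ-∣ (q ^ e) q∣y)
    q^s+e+1∤ : ¬ (q ^ suc (s + e) ∣ q ^ s * (y * q ^ e * R))
    q^s+e+1∤ d with euclidsLemma y R q-prime (*-cancelˡ-∣ (q ^ (s + e)) {{m^n≢0 q (s + e)}}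
                      (subst₂ _∣_ (*-comm q (q ^ (s + e))) X≡ d))
    ... | inj₁ q∣y = q∤y q∣y
    ... | inj₂ q∣R = q∤R q∣R

  split-power : ∀ A → 0 < A → ∃[ k ] ∃[ A' ] (A ≡ A' * q ^ k) × ¬ (q ∣ A')
  split-power A A>0 with val-exists A A>0
  ... | k , val (divides A' A≡) q^k+1∤A = k , A' , A≡ ,
        λ q∣A' → q^k+1∤A (subst (q * q ^ k ∣_) (sym A≡) (*-monoˡ-∣ (q ^ k) q∣A'))

quotient-double-bound : ∀ {N M r r' q} s t → N ≡ r + s * q → M ≡ r' + t * q → r' < q →
                        N ≤ suc (M + M) → s ≤ suc (t + t)
quotient-double-bound {N} {M} {r} {r'} {q} s t N≡ M≡ r'<q N≤2M+1 = ≮⇒≥ too-large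
  where
  expand-lhs : ∀ t q → suc (suc (t + t)) * q ≡ (q + q) + (t * q + t * q)
  expand-lhs = solve-∀
  expand-rhs : ∀ r t q → suc ((r + t * q) + (r + t * q)) ≡ (suc r + r) + (t * q + t * q)
  expand-rhs = solve-∀
  too-large : ¬ (suc (t + t) < s)
  too-large 2t+2≤s = <-irrefl refl (≤-<-trans lower upper)
    where
    lower : suc (suc (t + t)) * q ≤ suc (M + M)
    lower = ≤-trans (*-monoˡ-≤ q 2t+2≤s) (≤-trans (subst (s * q ≤_) (sym N≡) (m≤n+m (s * q) r)) N≤2M+1)
    upper : suc (M + M) < suc (suc (t + t)) * q
    upper = subst₂ _<_ (trans (sym (expand-rhs r' t q)) (cong (λ z → suc (z + z)) (sym M≡)))
                       (sym (expand-lhs t q))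
                       (+-monoˡ-< (t * q + t * q) (+-mono-≤-< r'<q r'<q))

legendre-step : ∀ q .{{_ : NonZero q}} s t a b N → s ≤ suc (t + t) → s * q ≤ N →
                q ^ a ≤ s * q ^ (b + b) → q ^ (s + a) ≤ N * q ^ ((t + b) + (t + b))
legendre-step q s t a b N s≤2t+1 sq≤N qᵃ≤ = begin
    q ^ (s + a)
  ≡⟨ ^-distribˡ-+-* q s a ⟩
    q ^ s * q ^ a
  ≤⟨ *-mono-≤ (^-monoʳ-≤ q s≤2t+1) qᵃ≤ ⟩
    q ^ suc (t + t) * (s * q ^ (b + b))
  ≡⟨ regroup q (q ^ (t + t)) s (q ^ (b + b)) ⟩
    (q * s) * (q ^ (t + t) * q ^ (b + b))
  ≡⟨ cong ((q * s) *_) (sym (^-distribˡ-+-* q (t + t) (b + b))) ⟩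
    (q * s) * q ^ ((t + t) + (b + b))
  ≡⟨ cong (λ z → (q * s) * q ^ z) (interchange t b) ⟩
    (q * s) * q ^ ((t + b) + (t + b))
  ≤⟨ *-monoˡ-≤ (q ^ ((t + b) + (t + b))) (subst (_≤ N) (*-comm s q) sq≤N) ⟩
    N * q ^ ((t + b) + (t + b)) ∎
  where
  open ≤-Reasoning
  regroup : ∀ q X s Y → (q * X) * (s * Y) ≡ (q * s) * (X * Y)
  regroup = solve-∀
  interchange : ∀ t b → (t + t) + (b + b) ≡ (t + b) + (t + b)
  interchange = solve-∀

module Legendre {q : ℕ} (q-prime : Prime q) where
  open Valuation q-prime

  -- Writing N = r + t·q with r < q, the multiples q, 2q, …, tq contribute
  -- q^t · t! to N!, and the remaining factors are prime to q.
  record FactorialSplit (N : ℕ) : Set where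
    constructor split
    field
      t r R : ℕ
      N≡    : N ≡ r + t * q
      r<q   : r < q
      q∤R   : ¬ (q ∣ R)
      N!≡   : N ! ≡ q ^ t * (t ! * R)

  factorial-split : ∀ N → FactorialSplit N
  factorial-split zero = split 0 0 1 refl (<-trans z<s q≥2) q∤1 refl
  factorial-split (suc N) with factorial-split N
  ... | split t r R N≡ r<q q∤R N!≡ with suc r <? q
  ...   | yes r+1<q = split t (suc r) (suc N * R) (cong suc N≡) r+1<q q∤[N+1]R N+1!≡
    where
    q∤N+1 : ¬ (q ∣ suc N)
    q∤N+1 q∣N+1 = <⇒≱ r+1<q (∣⇒≤ (∣m+n∣m⇒∣n
      (subst (q ∣_) (trans (cong suc N≡) (+-comm (suc r) (t * q))) q∣N+1) (n∣m*n t)))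
    q∤[N+1]R : ¬ (q ∣ suc N * R)
    q∤[N+1]R q∣ with euclidsLemma (suc N) R q-prime q∣
    ... | inj₁ q∣N+1 = q∤N+1 q∣N+1
    ... | inj₂ q∣R   = q∤R q∣R
    regroup : ∀ a p f R → a * (p * (f * R)) ≡ p * (f * (a * R))
    regroup = solve-∀
    N+1!≡ : suc N ! ≡ q ^ t * (t ! * (suc N * R))
    N+1!≡ = trans (cong (suc N *_) N!≡) (regroup (suc N) (q ^ t) (t !) R)
  ...   | no r+1≮q = split (suc t) 0 R N+1≡ (<-trans z<s q≥2) q∤R N+1!≡
    where
    N+1≡ : suc N ≡ suc t * q
    N+1≡ = trans (cong suc N≡) (cong (_+ t * q) (≤-antisym r<q (≮⇒≥ r+1≮q)))
    regroup : ∀ a q p f R → (a * q) * (p * (f * R)) ≡ (q * p) * ((a * f) * R)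
    regroup = solve-∀
    N+1!≡ : suc N ! ≡ q ^ suc t * (suc t ! * R)
    N+1!≡ = trans (cong (_* N !) N+1≡)
              (trans (cong (suc t * q *_) N!≡) (regroup (suc t) q (q ^ t) (t !) R))

  factorial-val : ∀ {N e} (sp : FactorialSplit N) → Val (FactorialSplit.t sp !) e →
                  Val (N !) (FactorialSplit.t sp + e)
  factorial-val {e = e} (split t _ _ _ _ q∤R N!≡) vt = subst (λ X → Val X (t + e)) (sym N!≡) (val-mul t vt q∤R)

  -- For 1 ≤ N ≤ 2M + 1: q^v(N!) ≤ N · q^(2 v(M!)); with N = 2m, M = m this
  -- bounds the power of q in binom(2m, m).  By induction along N ↦ ⌊N/q⌋,
  -- using Legendre's formula for N! and M!.
  LegendreBound : ℕ → Set
  LegendreBound N = ∀ M {a b} → 1 ≤ N → N ≤ suc (M + M) → Val (N !) a → Val (M !) b →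
                    q ^ a ≤ N * q ^ (b + b)

  legendre-bound : ∀ N → LegendreBound N
  legendre-bound = <-rec LegendreBound bound
    where
    bound : ∀ N → (∀ {N'} → N' < N → LegendreBound N') → LegendreBound N
    bound N rec M {b = b} 1≤N N≤2M+1 vN vM with factorial-split N | factorial-split M
    ... | spN@(split zero _ _ _ _ _ _) | _ =
      subst (λ a → q ^ a ≤ N * q ^ (b + b)) (sym (val-unique vN (factorial-val spN (val-zero q∤1))))
            (*-mono-≤ 1≤N (m^n>0 q (b + b)))
    ... | spN@(split s@(suc _) r _ N≡ _ _ _) | spM@(split t _ _ M≡ r'<q _ _)
        with val-exists (s !) (1≤n! s) | val-exists (t !) (1≤n! t)
    ...   | a' , va' | b' , vb' =
      subst₂ (λ a b → q ^ a ≤ N * q ^ (b + b))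
             (sym (val-unique vN (factorial-val spN va')))
             (sym (val-unique vM (factorial-val spM vb')))
             (legendre-step q s t a' b' N s≤2t+1 sq≤N (rec s<N t (s≤s z≤n) s≤2t+1 va' vb'))
      where
      sq≤N : s * q ≤ N
      sq≤N = subst (s * q ≤_) (sym N≡) (m≤n+m (s * q) r)
      s≤2t+1 : s ≤ suc (t + t)
      s≤2t+1 = quotient-double-bound {r = r} s t N≡ M≡ r'<q N≤2M+1
      s<N : s < N
      s<N = <-≤-trans (m<m*n s q q≥2) sq≤N

  binomial-prime-power : ∀ m C a → 1 ≤ m → (m + m) ! ≡ C * (m ! * m !) → q ^ a ∣ C → q ^ a ≤ m + m
  binomial-prime-power m C a 1≤m [2m]!≡ qᵃ∣C with val-exists (m !) (1≤n! m) | val-exists ((m + m) !) (1≤n! (m + m))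
  ... | b , vb | A , vA = *-cancelʳ-≤ (q ^ a) (m + m) (q ^ (b + b)) {{m^n≢0 q (b + b)}} (begin
      q ^ a * q ^ (b + b)       ≡⟨ ^-distribˡ-+-* q a (b + b) ⟨
      q ^ (a + (b + b))         ≤⟨ ^-monoʳ-≤ q (∣⇒≤-val (a + (b + b)) q^a+2b∣ vA) ⟩
      q ^ A                     ≤⟨ legendre-bound (m + m) m (≤-trans 1≤m (m≤m+n m m)) (n≤1+n (m + m)) vA vb ⟩
      (m + m) * q ^ (b + b)     ∎)
    where
    open ≤-Reasoning
    q^2b∣m!² : q ^ (b + b) ∣ m ! * m !
    q^2b∣m!² = subst (_∣ m ! * m !) (sym (^-distribˡ-+-* q b b)) (*-pres-∣ (Val.power∣ vb) (Val.power∣ vb))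
    q^a+2b∣ : q ^ (a + (b + b)) ∣ (m + m) !
    q^a+2b∣ = subst₂ _∣_ (sym (^-distribˡ-+-* q a (b + b))) (sym [2m]!≡) (*-pres-∣ qᵃ∣C q^2b∣m!²)

PrimePowersBoundedBy : ℕ → ℕ → Set
PrimePowersBoundedBy B A = ∀ r a → Prime r → r ^ a ∣ A → r ^ a ≤ B

-- If the prime powers dividing A are at most B, then A ≤ B^p or A has a prime
-- factor larger than p: each of the primes ≤ p contributes a factor ≤ B.
smooth-bound : ∀ p {A B} → 0 < A → 1 ≤ B → PrimePowersBoundedBy B A →
               A ≤ B ^ p ⊎ ∃[ r ] Prime r × r ∣ A × p < r
smooth-bound zero {A} A>0 B≥1 bounded with A ≤? 1
... | yes A≤1 = inj₁ A≤1
... | no  A≰1 with ∃prime-factor (≰⇒> A≰1)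
...   | r , pr , r∣A = inj₂ (r , pr , r∣A , >-nonZero⁻¹ r {{prime⇒nonZero pr}})
smooth-bound (suc p) {A} {B} A>0 B≥1 bounded with prime? (suc p)
... | no ¬prime[p+1] with smooth-bound p A>0 B≥1 bounded
...   | inj₁ A≤Bᵖ = inj₁ (≤-trans A≤Bᵖ (subst (_≤ B ^ suc p) (*-identityˡ (B ^ p)) (*-monoˡ-≤ (B ^ p) B≥1)))
...   | inj₂ (r , pr , r∣A , p<r) = inj₂ (r , pr , r∣A , ≤∧≢⇒< p<r λ { refl → ¬prime[p+1] pr })
smooth-bound (suc p) {A} {B} A>0 B≥1 bounded | yes prime[p+1] with Valuation.split-power prime[p+1] A A>0
... | k , A' , A≡ , p+1∤A' =
  combine (smooth-bound p A'>0 B≥1 (λ r a pr rᵃ∣A' → bounded r a pr (∣-trans rᵃ∣A' A'∣A)))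
  where
  A'∣A : A' ∣ A
  A'∣A = subst (A' ∣_) (sym A≡) (m∣m*n (suc p ^ k))
  A'>0 : 0 < A'
  A'>0 = >-nonZero⁻¹ A' {{m*n≢0⇒m≢0 A' {{subst NonZero A≡ (>-nonZero A>0)}}}}
  combine : A' ≤ B ^ p ⊎ ∃[ r ] Prime r × r ∣ A' × p < r → A ≤ B ^ suc p ⊎ ∃[ r ] Prime r × r ∣ A × suc p < r
  combine (inj₁ A'≤Bᵖ) = inj₁ (begin
    A                    ≡⟨ A≡ ⟩
    A' * suc p ^ k       ≤⟨ *-mono-≤ A'≤Bᵖ (bounded (suc p) k prime[p+1] (subst (suc p ^ k ∣_) (sym A≡) (n∣m*n A'))) ⟩
    B ^ p * B            ≡⟨ *-comm (B ^ p) B ⟩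
    B ^ suc p            ∎)
    where open ≤-Reasoning
  combine (inj₂ (r , pr , r∣A' , p<r)) = inj₂ (r , pr , ∣-trans r∣A' A'∣A , ≤∧≢⇒< p<r λ { refl → p+1∤A' r∣A' })

central-binomial-lower : ∀ m → 2 ^ m * (m ! * m !) ≤ (m + m) !
central-binomial-lower zero = ≤-refl
central-binomial-lower (suc m) = begin
    2 ^ suc m * (suc m ! * suc m !)
  ≡⟨ regroup (suc m) (2 ^ m) (m !) ⟩
    (2 * suc m * suc m) * (2 ^ m * (m ! * m !))
  ≤⟨ *-mono-≤ (*-mono-≤ (≤-reflexive (double m)) (s≤s (m≤m+n m m))) (central-binomial-lower m) ⟩
    (suc (suc (m + m)) * suc (m + m)) * (m + m) !
  ≡⟨ *-assoc (suc (suc (m + m))) (suc (m + m)) ((m + m) !) ⟩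
    suc (suc (m + m)) !
  ≡⟨ cong (λ k → suc k !) (+-suc m m) ⟨
    (suc m + suc m) ! ∎
  where
  open ≤-Reasoning
  regroup : ∀ s X f → (2 * X) * ((s * f) * (s * f)) ≡ (2 * s * s) * (X * (f * f))
  regroup = solve-∀
  double : ∀ m → 2 * suc m ≡ suc (suc (m + m))
  double = solve-∀

-- The oblong number (2c+1)·2c is below 2^c once c ≥ 9; it bounds 2m = 2p⌊p/2⌋.
oblong : ℕ → ℕ
oblong n = suc n * n

oblong-double-step : ∀ c → 3 ≤ c → oblong (suc c + suc c) ≤ 2 * oblong (c + c)
oblong-double-step c 3≤c with m≤n⇒∃[o]m+o≡n 3≤c
... | d , refl = subst (oblong (suc (3 + d) + suc (3 + d)) ≤_) (sym (expand d)) (m≤m+n _ _)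
  where
  expand : ∀ d → 2 * (suc ((3 + d) + (3 + d)) * ((3 + d) + (3 + d)))
                 ≡ suc ((4 + d) + (4 + d)) * ((4 + d) + (4 + d)) + (12 + 18 * d + 4 * (d * d))
  expand = solve-∀

oblong<2^ : ∀ c → 9 ≤ c → oblong (c + c) < 2 ^ c
oblong<2^ c 9≤c with m≤n⇒∃[o]m+o≡n 9≤c
... | d , refl = bound d
  where
  bound : ∀ d → oblong ((9 + d) + (9 + d)) < 2 ^ (9 + d)
  bound zero = from-yes (oblong 18 <? 2 ^ 9)
  bound (suc d) = begin-strict
    oblong ((9 + suc d) + (9 + suc d))   ≡⟨ cong (λ c → oblong (c + c)) (+-suc 9 d) ⟩
    oblong (suc (9 + d) + suc (9 + d))   ≤⟨ oblong-double-step (9 + d) (m≤m+n 3 (6 + d)) ⟩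
    2 * oblong ((9 + d) + (9 + d))       <⟨ *-monoʳ-< 2 (bound d) ⟩
    2 ^ suc (9 + d)                      ≡⟨ cong (2 ^_) (+-suc 9 d) ⟨
    2 ^ (9 + suc d)                      ∎
    where open ≤-Reasoning

-- Chebyshev's argument: if (2m)^p < 2^m, then binom(2m, m) has a prime factor
-- r with p < r; as r divides (2m)!, also r ≤ 2m.
binomial-large-prime : ∀ p m → 1 ≤ m → (m + m) ^ p < 2 ^ m → ∃[ r ] Prime r × p < r × r ≤ m + m
binomial-large-prime p m 1≤m [2m]ᵖ<2ᵐ = conclude (smooth-bound p C>0 (≤-trans 1≤m (m≤m+n m m)) bounded)
  where
  m!²∣[2m]! : m ! * m ! ∣ (m + m) !
  m!²∣[2m]! = subst (λ k → m ! * k ! ∣ (m + m) !) (m+n∸m≡n m m) (k![n∸k]!∣n! (m≤m+n m m))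
  C : ℕ
  C = quotient m!²∣[2m]!
  [2m]!≡ : (m + m) ! ≡ C * (m ! * m !)
  [2m]!≡ = m∣n⇒n≡quotient*m m!²∣[2m]!
  C>0 : 0 < C
  C>0 = >-nonZero⁻¹ C {{quotient≢0 m!²∣[2m]! {{(m + m) !≢0}}}}
  bounded : PrimePowersBoundedBy (m + m) C
  bounded r a pr rᵃ∣C = Legendre.binomial-prime-power pr m C a 1≤m [2m]!≡ rᵃ∣C
  2ᵐ≤C : 2 ^ m ≤ C
  2ᵐ≤C = *-cancelʳ-≤ (2 ^ m) C (m ! * m !) {{m !* m !≢0}}
           (subst (2 ^ m * (m ! * m !) ≤_) [2m]!≡ (central-binomial-lower m))
  conclude : C ≤ (m + m) ^ p ⊎ ∃[ r ] Prime r × r ∣ C × p < r → ∃[ r ] Prime r × p < r × r ≤ m + m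
  conclude (inj₁ C≤[2m]ᵖ) = ⊥-elim (<⇒≱ (<-≤-trans [2m]ᵖ<2ᵐ 2ᵐ≤C) C≤[2m]ᵖ)
  conclude (inj₂ (r , pr , r∣C , p<r)) = r , pr , p<r , prime∣!⇒≤ (m + m) pr (∣-trans r∣C (quotient-∣ m!²∣[2m]!))

halve : ∀ p → ∃[ c ] c + c ≤ p × p ≤ suc (c + c)
halve zero = 0 , z≤n , z≤n
halve (suc zero) = 0 , z≤n , ≤-refl
halve (suc (suc p)) with halve p
... | c , 2c≤p , p≤2c+1 = suc c , subst (_≤ suc (suc p)) (cong suc (sym (+-suc c c))) (s≤s (s≤s 2c≤p))
                                 , subst (suc (suc p) ≤_) (cong (λ k → suc (suc k)) (sym (+-suc c c))) (s≤s (s≤s p≤2c+1))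

-- For p ≥ 19 take m = p⌊p/2⌋: then 2m ≤ p² and (2m)^p < 2^m.
bertrand-square-large : ∀ p → 19 ≤ p → ∃[ r ] Prime r × p < r × r ≤ p * p
bertrand-square-large p 19≤p with halve p
... | c , 2c≤p , p≤2c+1 with binomial-large-prime p (p * c) 1≤m [2m]ᵖ<2ᵐ
  where
  instance
    p≢0 : NonZero p
    p≢0 = >-nonZero (<-≤-trans z<s 19≤p)
  9≤c : 9 ≤ c
  9≤c = ≮⇒≥ λ c<9 → ≤⇒≯ (≤-trans 19≤p (≤-trans p≤2c+1 (s≤s (+-mono-≤ (s≤s⁻¹ c<9) (s≤s⁻¹ c<9)))))
                          (from-yes (17 <? 19))
  1≤m : 1 ≤ p * c
  1≤m = *-mono-≤ (<-≤-trans z<s 19≤p) (<-≤-trans z<s 9≤c)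
  [2m]ᵖ<2ᵐ : (p * c + p * c) ^ p < 2 ^ (p * c)
  [2m]ᵖ<2ᵐ = begin-strict
    (p * c + p * c) ^ p   ≡⟨ cong (_^ p) (*-distribˡ-+ p c c) ⟨
    (p * (c + c)) ^ p     ≤⟨ ^-monoˡ-≤ p (*-monoˡ-≤ (c + c) p≤2c+1) ⟩
    oblong (c + c) ^ p    <⟨ ^-monoˡ-< p (oblong<2^ c 9≤c) ⟩
    (2 ^ c) ^ p           ≡⟨ ^-*-assoc 2 c p ⟩
    2 ^ (c * p)           ≡⟨ cong (2 ^_) (*-comm c p) ⟩
    2 ^ (p * c)           ∎
    where open ≤-Reasoning
... | r , pr , p<r , r≤2m = r , pr , p<r ,
      ≤-trans r≤2m (subst (_≤ p * p) (*-distribˡ-+ p c c) (*-monoʳ-≤ p 2c≤p))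

bertrand-square : ∀ p → 2 ≤ p → ∃[ r ] Prime r × p < r × r ≤ p * p
bertrand-square p 2≤p = by-cases
  where
  witness : ∀ r a → Prime r → r ≤ a * a → a ≤ p → p < r → ∃[ r ] Prime r × p < r × r ≤ p * p
  witness r a pr r≤a² a≤p p<r = r , pr , p<r , ≤-trans r≤a² (*-mono-≤ a≤p a≤p)
  by-cases : ∃[ r ] Prime r × p < r × r ≤ p * p
  by-cases with p <? 3
  ... | yes p<3 = witness 3 2 (from-yes (prime? 3)) (from-yes (3 ≤? 4)) 2≤p p<3
  ... | no p≮3 with p <? 5
  ...   | yes p<5 = witness 5 3 (from-yes (prime? 5)) (from-yes (5 ≤? 9)) (≮⇒≥ p≮3) p<5
  ...   | no p≮5 with p <? 11
  ...     | yes p<11 = witness 11 5 (from-yes (prime? 11)) (from-yes (11 ≤? 25)) (≮⇒≥ p≮5) p<11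
  ...     | no p≮11 with p <? 17
  ...       | yes p<17 = witness 17 11 (from-yes (prime? 17)) (from-yes (17 ≤? 121)) (≮⇒≥ p≮11) p<17
  ...       | no p≮17 with p <? 19
  ...         | yes p<19 = witness 19 17 (from-yes (prime? 19)) (from-yes (19 ≤? 289)) (≮⇒≥ p≮17) p<19
  ...         | no p≮19 = bertrand-square-large p (≮⇒≥ p≮19)

primesBelow-suc : ∀ x → primesBelow (suc x) ≡ primesBelow x + length (filter prime? [ x ])
primesBelow-suc x = begin
    length (filter prime? (upTo (suc x)))
  ≡⟨ cong (λ l → length (filter prime? l)) (upTo-∷ʳ x) ⟨
    length (filter prime? (upTo x ++ [ x ]))
  ≡⟨ cong length (filter-++ prime? (upTo x) [ x ]) ⟩
    length (filter prime? (upTo x) ++ filter prime? [ x ])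
  ≡⟨ length-++ (filter prime? (upTo x)) ⟩
    primesBelow x + length (filter prime? [ x ]) ∎
  where open ≡-Reasoning

primesBelow-suc-prime : ∀ {x} → Prime x → primesBelow (suc x) ≡ suc (primesBelow x)
primesBelow-suc-prime {x} px with primesBelow-suc x
... | step with prime? x
...   | yes _ = trans step (+-comm (primesBelow x) 1)
...   | no ¬px = ⊥-elim (¬px px)

primesBelow-mono : ∀ {x y} → x ≤ y → primesBelow x ≤ primesBelow y
primesBelow-mono {y = zero} z≤n = ≤-refl
primesBelow-mono {x} {suc y} x≤y+1 with m≤n⇒m<n∨m≡n x≤y+1
... | inj₂ refl = ≤-refl
... | inj₁ x<y+1 = ≤-trans (primesBelow-mono (s≤s⁻¹ x<y+1))
                           (subst (primesBelow y ≤_) (sym (primesBelow-suc y)) (m≤m+n _ _))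

primesBelow-prime-< : ∀ {x y} → Prime x → x < y → primesBelow x < primesBelow y
primesBelow-prime-< px x<y = subst (_≤ _) (primesBelow-suc-prime px) (primesBelow-mono x<y)

nth-prime-< : ∀ {i j r s} → IsNthPrime i r → IsNthPrime j s → i < j → r < s
nth-prime-< (_ , refl) (_ , refl) i<j = ≰⇒> λ s≤r → <⇒≱ i<j (s≤s (primesBelow-mono s≤r))

earlier-prime : ∀ {n pn r} → IsNthPrime n pn → Prime r → r < pn →
                IsNthPrime (suc (primesBelow r)) r × suc (primesBelow r) ≤ n ∸ 1
earlier-prime (_ , refl) pr r<pn = (pr , refl) , primesBelow-prime-< pr r<pn

no-prime-between : ∀ {n pn pn1 r} → IsNthPrime n pn → IsNthPrime (suc n) pn1 → Prime r → pn < r → pn1 ≤ r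
no-prime-between {r = r} (ppn , refl) (_ , π[pn1]≡) pr pn<r = ≮⇒≥ λ r<pn1 →
  <⇒≱ (primesBelow-prime-< pr r<pn1)
      (subst (_≤ primesBelow r) (sym (suc-injective π[pn1]≡)) (primesBelow-prime-< ppn pn<r))

PrimeFactorsAtLeast : ℕ → ℕ → Set
PrimeFactorsAtLeast p n = ∀ r → Prime r → r ∣ n → p ≤ r

InM⇒prime-factors≥ : ∀ {n pn q} → IsNthPrime n pn → InM (n ∸ 1) q → PrimeFactorsAtLeast pn q
InM⇒prime-factors≥ Ipn (_ , coprime) r pr r∣q = ≮⇒≥ λ r<pn →
  let (Ir , index≤) = earlier-prime Ipn pr r<pn in coprime _ r (s≤s z≤n) index≤ Ir r∣q

prime⇒InM : ∀ {n pn q} → IsNthPrime n pn → Prime q → pn < q → InM (n ∸ 1) q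
prime⇒InM Ipn@(_ , refl) pq pn<q = <-≤-trans z<s pn<q , λ i r _ i≤n-1 Ir r∣q →
  <-irrefl (prime∣prime (proj₁ Ir) pq r∣q) (<-trans (nth-prime-< Ir Ipn (s≤s i≤n-1)) pn<q)

module FactorDichotomy {p p' : ℕ} (gap : ∀ r → Prime r → p < r → p' ≤ r) (p'≤p² : p' ≤ p * p) where

  -- A number b ≥ 2 whose prime factors are all ≥ p is p itself or at least p':
  -- a prime factor r > p gives b ≥ r ≥ p'; if r = p, the cofactor is 1 or
  -- has a prime factor ≥ p, so that b ≥ p² ≥ p'.
  dichotomy : ∀ {b} → 2 ≤ b → PrimeFactorsAtLeast p b → b ≡ p ⊎ p' ≤ b
  dichotomy {b} 2≤b large with ∃prime-factor 2≤b
  ... | r , pr , r∣b@(divides u b≡ur) with m≤n⇒m<n∨m≡n (large r pr r∣b)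
  ...   | inj₁ p<r = inj₂ (≤-trans (gap r pr p<r) (∣⇒≤ {{>-nonZero (<-trans z<s 2≤b)}} r∣b))
  ...   | inj₂ refl = cofactor u b≡ur
    where
    cofactor : ∀ u → b ≡ u * p → b ≡ p ⊎ p' ≤ b
    cofactor zero b≡0 = ⊥-elim (<-irrefl (sym b≡0) (<-trans z<s 2≤b))
    cofactor (suc zero) b≡p = inj₁ (trans b≡p (*-identityˡ p))
    cofactor u@(suc (suc _)) b≡up with ∃prime-factor {u} (s≤s (s≤s z≤n))
    ... | r' , pr' , r'∣u = inj₂ (begin
      p'      ≤⟨ p'≤p² ⟩
      p * p   ≤⟨ *-monoˡ-≤ p (≤-trans p≤r' (∣⇒≤ r'∣u)) ⟩
      u * p   ≡⟨ b≡up ⟨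
      b       ∎)
      where
      open ≤-Reasoning
      p≤r' : p ≤ r'
      p≤r' = large r' pr' (∣-trans r'∣u (divides p (trans b≡up (*-comm u p))))

  composite-bound : ∀ {q} → p ≤ p' → ¬ Prime q → 2 ≤ q → PrimeFactorsAtLeast p q → q ≢ p * p → p * p' ≤ q
  composite-bound {q} p≤p' ¬pq 2≤q large q≢p² with ∃prime-factor 2≤q
  ... | a , pa , divides b q≡ba = by-cases b q≡ba
    where
    factor≥ : ∀ {d} → d ∣ q → PrimeFactorsAtLeast p d
    factor≥ d∣q r pr r∣d = large r pr (∣-trans r∣d d∣q)
    by-cases : ∀ b → q ≡ b * a → p * p' ≤ q
    by-cases zero q≡0 = ⊥-elim (<-irrefl (sym q≡0) (<-trans z<s 2≤q))
    by-cases (suc zero) q≡a = ⊥-elim (¬pq (subst Prime (sym (trans q≡a (*-identityˡ a))) pa))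
    by-cases b@(suc (suc _)) q≡ba
      with dichotomy (prime≥2 pa) (factor≥ (divides b q≡ba))
         | dichotomy (s≤s (s≤s z≤n)) (factor≥ (divides a (trans q≡ba (*-comm b a))))
    ... | inj₁ refl | inj₁ refl = ⊥-elim (q≢p² q≡ba)
    ... | inj₁ refl | inj₂ p'≤b = subst (_ ≤_) (trans (*-comm a b) (sym q≡ba)) (*-monoʳ-≤ a p'≤b)
    ... | inj₂ p'≤a | inj₁ refl = subst (_ ≤_) (sym q≡ba) (*-monoʳ-≤ b p'≤a)
    ... | inj₂ p'≤a | inj₂ p'≤b = subst (_ ≤_) (sym q≡ba) (*-mono-≤ (≤-trans p≤p' p'≤b) p'≤a)

-- The proposition: p_{n+1} ≤ p_n² by the Bertrand-type bound, and the factor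
-- dichotomy for p = p_n, p' = p_{n+1} excludes composites.  (The argument
-- does not need n ≥ 2.)
proposition2 : ∀ (n pn pn1 q : ℕ) → 2 ≤ n → IsNthPrime n pn → IsNthPrime (suc n) pn1
    → ((InM (n ∸ 1) q × pn < q × q < pn * pn1 × ¬ (q ≡ pn * pn)) ⇔ (Prime q × pn < q × q < pn * pn1))
proposition2 n pn pn1 q _ Ipn@(ppn , _) Ipn1 = mk⇔ forward backward
  where
  gap : ∀ r → Prime r → pn < r → pn1 ≤ r
  gap r pr = no-prime-between Ipn Ipn1 pr
  pn1≤pn² : pn1 ≤ pn * pn
  pn1≤pn² with bertrand-square pn (prime≥2 ppn)
  ... | r , pr , pn<r , r≤pn² = ≤-trans (gap r pr pn<r) r≤pn²
  open FactorDichotomy gap pn1≤pn²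

  forward : InM (n ∸ 1) q × pn < q × q < pn * pn1 × ¬ (q ≡ pn * pn) → Prime q × pn < q × q < pn * pn1
  forward (inM , pn<q , q<pnpn1 , q≢pn²) with prime? q
  ... | yes pq = pq , pn<q , q<pnpn1
  ... | no ¬pq = ⊥-elim (<⇒≱ q<pnpn1 (composite-bound (<⇒≤ (nth-prime-< Ipn Ipn1 ≤-refl)) ¬pq
                          (≤-trans (prime≥2 ppn) (<⇒≤ pn<q)) (InM⇒prime-factors≥ Ipn inM) q≢pn²))

  backward : Prime q × pn < q × q < pn * pn1 → InM (n ∸ 1) q × pn < q × q < pn * pn1 × ¬ (q ≡ pn * pn)
  backward (pq , pn<q , q<pnpn1) = prime⇒InM Ipn pq pn<q , pn<q , q<pnpn1 ,
    λ q≡pn² → <⇒≢ pn<q (prime∣prime ppn pq (divides pn q≡pn²))
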